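{- Let $G$ be a graph on $[n]$ whose edges are pairs $(i,j)$ with $i<j$ and which contains the path edges $(1,2),\dots,(n-1,n)$, and let $\lambda^n=(2,1,1,\dots,1,0)\in\mathbb{Z}^n$. If $t\in\mathcal{N}_{\lambda^n,E_n-E(G)}$, then either $t=\lambda^n+\omega^n$, or $t_1,\dots,t_n$ is a permutation of $[n]$ with $t_1=n$ and $t_n=1$.
   Context: $E_n=\{(i,j):1\le i<j\le n\}$, $\omega^n=(n-1,n-2,\dots,1,0)$. For $e=(a,b)\in E_n$, $v(e)\in\mathbb{Z}^n$ has $-1$ in coordinate $a$, $1$ in coordinate $b$, $0$ elsewhere; $v(E)=\sum_{e\in E}v(e)$. For a partition $\lambda$ and $F\subseteq E_n$, $\mathcal{N}_{\lambda,F}$ is the set of $t\in\mathbb{Z}^n_{\ge0}$ with pairwise distinct entries for which there exists $E\subseteq F$ with $\lambda+\omega^n+v(E)=t$. -}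

module Defs where

open import Data.Nat as ℕ using (ℕ; zero; suc)
open import Data.Integer as ℤ using (ℤ; +_; 0ℤ; 1ℤ)
open import Data.Fin using (Fin; toℕ; _<_; _≟_; fromℕ<) renaming (zero to Fzero; suc to Fsuc)
open import Data.Nat using (_≤_; s≤s; z≤n)
open import Data.Bool using (Bool; true; false; if_then_else_)
open import Data.Product using (Σ; ∃; _×_)
open import Relation.Nullary using (¬_; does)
open import Relation.Binary.PropositionalEquality using (_≡_; _≢_)

sumFin : ∀ {n} → (Fin n → ℤ) → ℤ
sumFin {zero}  f = 0ℤ
sumFin {suc n} f = f Fzero ℤ.+ sumFin (λ i → f (Fsuc i))

δ : ∀ {n} → Fin n → Fin n → ℤ
δ i j = if does (i ≟ j) then 1ℤ else 0ℤ

-- E_n : pairs (i,j) with i < j (coordinates indexed by Fin n, 0-based).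
Eₙ : ∀ {n} → Fin n → Fin n → Set
Eₙ i j = i < j

ω : (n : ℕ) → Fin n → ℤ
ω n k = + (n ℕ.∸ suc (toℕ k))

v : ∀ {n} → Fin n → Fin n → Fin n → ℤ
v a b k = δ k b ℤ.- δ k a

-- A finite edge set E given by its indicator; v(E) = Σ_{e ∈ E} v(e).
vE : ∀ {n} → (Fin n → Fin n → Bool) → Fin n → ℤ
vE E k = sumFin (λ a → sumFin (λ b → if E a b then v a b k else 0ℤ))

_⊆E_ : ∀ {n} → (Fin n → Fin n → Bool) → (Fin n → Fin n → Set) → Set
E ⊆E F = ∀ a b → E a b ≡ true → F a b

-- N_{λ,F}: t ∈ Z^n_{≥0} (here ℕ-valued) with pairwise distinct entries,
-- such that λ + ω^n + v(E) = t for some E ⊆ F.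
𝒩 : (n : ℕ) → (Fin n → ℤ) → (Fin n → Fin n → Set) → (Fin n → ℕ) → Set
𝒩 n lam F t =
  (∀ i j → i ≢ j → t i ≢ t j) ×
  ∃ λ (E : Fin n → Fin n → Bool) →
    E ⊆E F × (∀ k → lam k ℤ.+ ω n k ℤ.+ vE E k ≡ + t k)

λⁿ : (n : ℕ) → Fin n → ℤ
λⁿ n k = if does (toℕ k ℕ.≟ 0) then + 2
         else if does (suc (toℕ k) ℕ.≟ n) then 0ℤ else 1ℤ

_−G_ : ∀ {n} → (Fin n → Fin n → Set) → (Fin n → Fin n → Set) → Fin n → Fin n → Set
(A −G G) i j = A i j × ¬ G i j

-- The first coordinate (index 1 in the paper) and the last (index n), given n ≥ 2.
first : (n : ℕ) → 2 ≤ n → Fin n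
first (suc (suc m)) (s≤s (s≤s _)) = Fzero

last : (n : ℕ) → 2 ≤ n → Fin n
last (suc (suc m)) (s≤s (s≤s _)) = fromℕ< {suc m} (s≤s (s≤s (≤-refl′ m)))
  where
  ≤-refl′ : ∀ k → k ≤ k
  ≤-refl′ zero = z≤n
  ≤-refl′ (suc k) = s≤s (≤-refl′ k)

module Submission where

-- Let n = N + 2, vertices 0 … N+1, b = λⁿ + ωⁿ = (n+1, n−1, n−2, …, 2, 0) and
-- t = b + v(E) with E a set of non-path edges, i.e. every edge (a, c) has c ≥ a + 2.
-- Coordinatewise this reads  t k + out(k) = b k + in(k)  (the balance equation), and
-- the degree bounds  out(k) ≤ n − (k+2),  in(k) ≤ k − 1  give  t k < n  for k ≠ 0
-- and  t k ≥ 2  for k ≠ N+1.  As t is injective, the N interior values fill the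
-- interval [2, n) (pigeonhole), hence t 0 ≥ n, t (N+1) ≤ 1 and out(0) ≤ 1.
--   * out(0) = 0: a forward induction shows that every out-degree vanishes: the
--     value b m must be carried by vertex m itself, which forces out(m) = 0.  So t = b.
--   * out(0) = 1: then t 0 = n and t (N+1) = in(N+1) ≤ 1.  If in(N+1) = 0, the mirror
--     backward induction makes every in-degree vanish, contradicting out(0) = 1; so
--     t (N+1) = 1 and t is injective with values in [1, n], i.e. a permutation of [n].
-- The file first proves general facts (sums over Fin, counting, v(E) as in − out,
-- pigeonhole on intervals), then works in a module fixing the data of the theorem.

module NonPathEdges where

  open import Defs
  open import Data.Nat as ℕ using (ℕ; zero; suc; pred; _+_; _∸_; _≤_; _<_; z≤n; s≤s; s≤s⁻¹)
  open import Data.Nat.Properties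
  open import Data.Integer as ℤ using (ℤ; +_; 0ℤ; 1ℤ)
  import Data.Integer.Properties as ℤP
  open import Data.Integer.Tactic.RingSolver using (solve-∀)
  open import Data.Fin as Fin using (Fin; toℕ; fromℕ<; inject₁) renaming (zero to Fzero; suc to Fsuc)
  import Data.Fin.Properties as FinP
  open import Data.Fin.Permutation using (Permutation′; _⟨$⟩ʳ_; _⟨$⟩ˡ_; permutation; inverseʳ)
  open import Data.Bool using (Bool; true; false; if_then_else_)
  open import Data.Product using (∃; _×_; _,_; proj₁; proj₂)
  open import Data.Sum using (_⊎_; inj₁; inj₂)
  open import Data.Empty using (⊥-elim)
  open import Function using (_∘_)
  open import Function.Definitions using (Injective)
  open import Relation.Nullary using (yes; no; does)
  open import Relation.Nullary.Decidable using (dec-true; dec-false)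
  open import Relation.Binary using (tri<; tri≈; tri>)
  open import Relation.Binary.PropositionalEquality

  sumFin-cong : ∀ {n} {f g : Fin n → ℤ} → (∀ i → f i ≡ g i) → sumFin f ≡ sumFin g
  sumFin-cong {zero}  f≡g = refl
  sumFin-cong {suc n} f≡g = cong₂ ℤ._+_ (f≡g Fzero) (sumFin-cong (f≡g ∘ Fsuc))

  sumFin-sub : ∀ {n} (f g : Fin n → ℤ) → sumFin (λ i → f i ℤ.- g i) ≡ sumFin f ℤ.- sumFin g
  sumFin-sub {zero}  f g = refl
  sumFin-sub {suc n} f g =
    trans (cong (ℤ._+_ (f Fzero ℤ.- g Fzero)) (sumFin-sub (f ∘ Fsuc) (g ∘ Fsuc)))
          (interchange (f Fzero) (g Fzero) (sumFin (f ∘ Fsuc)) (sumFin (g ∘ Fsuc)))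
    where
    interchange : ∀ a b c d → (a ℤ.- b) ℤ.+ (c ℤ.- d) ≡ (a ℤ.+ c) ℤ.- (b ℤ.+ d)
    interchange = solve-∀

  sumFin-zero : ∀ {n} (f : Fin n → ℤ) → (∀ i → f i ≡ 0ℤ) → sumFin f ≡ 0ℤ
  sumFin-zero {zero}  f f≡0 = refl
  sumFin-zero {suc n} f f≡0 = cong₂ ℤ._+_ (f≡0 Fzero) (sumFin-zero (f ∘ Fsuc) (f≡0 ∘ Fsuc))

  sumFin-single : ∀ {n} (f : Fin n → ℤ) k → (∀ i → i ≢ k → f i ≡ 0ℤ) → sumFin f ≡ f k
  sumFin-single {suc n} f Fzero off-k =
    trans (cong (ℤ._+_ (f Fzero)) (sumFin-zero (f ∘ Fsuc) (λ i → off-k (Fsuc i) (λ ())))) (ℤP.+-identityʳ (f Fzero))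
  sumFin-single {suc n} f (Fsuc k) off-k =
    trans (cong (λ x → x ℤ.+ sumFin (f ∘ Fsuc)) (off-k Fzero (λ ())))
          (trans (ℤP.+-identityˡ _) (sumFin-single (f ∘ Fsuc) k (λ i i≢k → off-k (Fsuc i) (i≢k ∘ FinP.suc-injective))))

  ⟦_⟧ : Bool → ℤ
  ⟦ b ⟧ = if b then 1ℤ else 0ℤ

  count : ∀ {n} → (Fin n → Bool) → ℕ
  count {zero}  f = 0
  count {suc n} f = (if f Fzero then 1 else 0) + count (f ∘ Fsuc)

  sumFin-count : ∀ {n} (f : Fin n → Bool) → sumFin (λ i → ⟦ f i ⟧) ≡ + count f
  sumFin-count {zero}  f = refl
  sumFin-count {suc n} f with f Fzero
  ... | true  = trans (cong (ℤ._+_ 1ℤ) (sumFin-count (f ∘ Fsuc))) (sym (ℤP.pos-+ 1 (count (f ∘ Fsuc))))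
  ... | false = trans (ℤP.+-identityˡ _) (sumFin-count (f ∘ Fsuc))

  count-zero : ∀ {n} (f : Fin n → Bool) → count f ≡ 0 → ∀ i → f i ≢ true
  count-zero {suc n} f count≡0 i fi with f Fzero in f0
  count-zero {suc n} f ()      i        fi | true
  count-zero {suc n} f count≡0 Fzero    fi | false = true≢false (trans (sym fi) f0)
    where
    true≢false : true ≢ false
    true≢false ()
  count-zero {suc n} f count≡0 (Fsuc i) fi | false = count-zero (f ∘ Fsuc) count≡0 i fi

  pred-∸-pred : ∀ hi lo → pred hi ∸ pred lo ≤ hi ∸ lo
  pred-∸-pred hi       zero     = pred[n]≤n
  pred-∸-pred zero     (suc lo) = ≤-reflexive (0∸n≡0 lo)
  pred-∸-pred (suc hi) (suc lo) = ≤-refl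

  count-window : ∀ {n} (f : Fin n → Bool) lo hi →
                 (∀ i → f i ≡ true → lo ≤ toℕ i × toℕ i < hi) → count f ≤ hi ∸ lo
  count-window {zero}  f lo hi inside = z≤n
  count-window {suc n} f lo hi inside with f Fzero in f0
  ... | true with inside Fzero f0
  ...   | z≤n , s≤s _ = s≤s (count-window (f ∘ Fsuc) 0 (pred hi) tail-inside)
    where
    tail-inside : ∀ i → f (Fsuc i) ≡ true → 0 ≤ toℕ i × toℕ i < pred hi
    tail-inside i fi = z≤n , pred-mono-≤ (proj₂ (inside (Fsuc i) fi))
  count-window {suc n} f lo hi inside | false =
    ≤-trans (count-window (f ∘ Fsuc) (pred lo) (pred hi) tail-inside) (pred-∸-pred hi lo)
    where
    tail-inside : ∀ i → f (Fsuc i) ≡ true → pred lo ≤ toℕ i × toℕ i < pred hi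
    tail-inside i fi = pred-mono-≤ (proj₁ (inside (Fsuc i) fi)) , pred-mono-≤ (proj₂ (inside (Fsuc i) fi))

  window-sum : ∀ {o lo hi} → o ≤ hi ∸ lo → lo ≤ hi → lo + o ≤ hi
  window-sum {o} {lo} o≤ lo≤hi = ≤-trans (+-monoʳ-≤ lo o≤) (≤-reflexive (m+[n∸m]≡n lo≤hi))

  δ-refl : ∀ {n} (k : Fin n) → δ k k ≡ 1ℤ
  δ-refl k = cong (λ b → if b then 1ℤ else 0ℤ) (dec-true (k Fin.≟ k) refl)

  δ-≢ : ∀ {n} (k b : Fin n) → k ≢ b → δ k b ≡ 0ℤ
  δ-≢ k b k≢b = cong (λ x → if x then 1ℤ else 0ℤ) (dec-false (k Fin.≟ b) k≢b)

  if-zero : ∀ x {z} → z ≡ 0ℤ → (if x then z else 0ℤ) ≡ 0ℤ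
  if-zero true  z≡0 = z≡0
  if-zero false _   = refl

  if-δ : ∀ {n} x (k : Fin n) → (if x then δ k k else 0ℤ) ≡ ⟦ x ⟧
  if-δ true  k = δ-refl k
  if-δ false k = refl

  if-sub : ∀ x a b → (if x then a ℤ.- b else 0ℤ) ≡ (if x then a else 0ℤ) ℤ.- (if x then b else 0ℤ)
  if-sub true  a b = refl
  if-sub false a b = refl

  vE-degrees : ∀ {n} (E : Fin n → Fin n → Bool) k →
               vE E k ≡ + count (λ a → E a k) ℤ.- + count (E k)
  vE-degrees {n} E k = begin
    vE E k
      ≡⟨ sumFin-cong (λ a → trans (sumFin-cong (λ b → if-sub (E a b) _ _)) (sumFin-sub (entering a) (leaving a))) ⟩
    sumFin (λ a → sumFin (entering a) ℤ.- sumFin (leaving a))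
      ≡⟨ sumFin-sub (λ a → sumFin (entering a)) (λ a → sumFin (leaving a)) ⟩
    sumFin (λ a → sumFin (entering a)) ℤ.- sumFin (λ a → sumFin (leaving a))
      ≡⟨ cong₂ ℤ._-_ all-entering all-leaving ⟩
    + count (λ a → E a k) ℤ.- + count (E k) ∎
    where
    open ≡-Reasoning
    entering leaving : Fin n → Fin n → ℤ
    entering a b = if E a b then δ k b else 0ℤ
    leaving  a b = if E a b then δ k a else 0ℤ

    all-entering : sumFin (λ a → sumFin (entering a)) ≡ + count (λ a → E a k)
    all-entering = trans (sumFin-cong entering-from) (sumFin-count (λ a → E a k))
      where
      entering-from : ∀ a → sumFin (entering a) ≡ ⟦ E a k ⟧
      entering-from a = trans (sumFin-single (entering a) k (λ b b≢k → if-zero (E a b) (δ-≢ k b (b≢k ∘ sym))))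
                              (if-δ (E a k) k)

    all-leaving : sumFin (λ a → sumFin (leaving a)) ≡ + count (E k)
    all-leaving = begin
      sumFin (λ a → sumFin (leaving a))
        ≡⟨ sumFin-single _ k (λ a a≢k → sumFin-zero (leaving a) (λ b → if-zero (E a b) (δ-≢ k a (a≢k ∘ sym)))) ⟩
      sumFin (leaving k)
        ≡⟨ sumFin-cong (λ b → if-δ (E k b) k) ⟩
      sumFin (λ b → ⟦ E k b ⟧)
        ≡⟨ sumFin-count (E k) ⟩
      + count (E k) ∎

  injective⇒surjective : ∀ {m} (f : Fin m → Fin m) → Injective _≡_ _≡_ f → ∀ y → ∃ λ x → f x ≡ y
  injective⇒surjective {suc m} f f-inj y with FinP.any? (λ x → f x Fin.≟ y)
  ... | yes hit = hit
  ... | no miss = ⊥-elim (1+n≰n (FinP.injective⇒≤ {f = avoid} avoid-inj))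
    where
    y≢f : ∀ x → y ≢ f x
    y≢f x y≡fx = miss (x , sym y≡fx)
    -- f with the missed value y squeezed out: an injection Fin (m+1) → Fin m.
    avoid : Fin (suc m) → Fin m
    avoid x = Fin.punchOut (y≢f x)
    avoid-inj : Injective _≡_ _≡_ avoid
    avoid-inj {x} {z} eq = f-inj (FinP.punchOut-injective (y≢f x) (y≢f z) eq)

  injective⇒permutation : ∀ {m} (f : Fin m → Fin m) → Injective _≡_ _≡_ f →
                          ∃ λ (π : Permutation′ m) → ∀ i → π ⟨$⟩ʳ i ≡ f i
  injective⇒permutation f f-inj =
    permutation f preimage (proj₂ ∘ onto) (λ x → f-inj (proj₂ (onto (f x)))) , λ _ → refl
    where
    onto = injective⇒surjective f f-inj
    preimage = proj₁ ∘ onto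

  interval-permutation : ∀ {m} (t : Fin m → ℕ) lo → Injective _≡_ _≡_ t →
                         (∀ i → lo ≤ t i × t i < lo + m) →
                         ∃ λ (π : Permutation′ m) → ∀ i → t i ≡ lo + toℕ (π ⟨$⟩ʳ i)
  interval-permutation {m} t lo t-inj in-range = π , λ i → begin
    t i                    ≡⟨ sym (m+[n∸m]≡n (proj₁ (in-range i))) ⟩
    lo + (t i ∸ lo)        ≡⟨ cong (_+_ lo) (sym (FinP.toℕ-fromℕ< (offset<m i))) ⟩
    lo + toℕ (shift i)     ≡⟨ cong (λ j → lo + toℕ j) (sym (π≡shift i)) ⟩
    lo + toℕ (π ⟨$⟩ʳ i)    ∎
    where
    open ≡-Reasoning
    offset<m : ∀ i → t i ∸ lo < m
    offset<m i = +-cancelˡ-< lo (t i ∸ lo) m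
                   (subst (_< lo + m) (sym (m+[n∸m]≡n (proj₁ (in-range i)))) (proj₂ (in-range i)))
    shift : Fin m → Fin m
    shift i = fromℕ< (offset<m i)
    shift-inj : Injective _≡_ _≡_ shift
    shift-inj {i} {j} eq = t-inj (∸-cancelʳ-≡ (proj₁ (in-range i)) (proj₁ (in-range j))
      (trans (sym (FinP.toℕ-fromℕ< (offset<m i))) (trans (cong toℕ eq) (FinP.toℕ-fromℕ< (offset<m j)))))
    π : Permutation′ m
    π = proj₁ (injective⇒permutation shift shift-inj)
    π≡shift : ∀ i → π ⟨$⟩ʳ i ≡ shift i
    π≡shift = proj₂ (injective⇒permutation shift shift-inj)

  ≤1⇒0⊎1 : ∀ {x} → x ≤ 1 → x ≡ 0 ⊎ x ≡ 1
  ≤1⇒0⊎1 x≤1 with m≤n⇒m<n∨m≡n x≤1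
  ... | inj₁ x<1 = inj₁ (n<1⇒n≡0 x<1)
  ... | inj₂ x≡1 = inj₂ x≡1

  module Setting (N : ℕ)
    (G : Fin (suc (suc N)) → Fin (suc (suc N)) → Set)
    (path : ∀ (i j : Fin (suc (suc N))) → suc (toℕ i) ≡ toℕ j → G i j)
    (t : Fin (suc (suc N)) → ℕ)
    (distinct : ∀ i j → i ≢ j → t i ≢ t j)
    (E : Fin (suc (suc N)) → Fin (suc (suc N)) → Bool)
    (E⊆F : E ⊆E (Eₙ −G G))
    (t-def : ∀ k → λⁿ (suc (suc N)) k ℤ.+ ω (suc (suc N)) k ℤ.+ vE E k ≡ + t k)
    where

    n : ℕ
    n = suc (suc N)

    lst : Fin n
    lst = last n (s≤s (s≤s z≤n))

    toℕ-lst : toℕ lst ≡ suc N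
    toℕ-lst = FinP.toℕ-fromℕ< (n<1+n (suc N))

    t-inj : Injective _≡_ _≡_ t
    t-inj {i} {j} ti≡tj with i Fin.≟ j
    ... | yes i≡j = i≡j
    ... | no i≢j  = ⊥-elim (distinct i j i≢j ti≡tj)

    data Position : ℕ → Set where
      at-first : Position 0
      interior : ∀ {i} → 1 ≤ i → i ≤ N → Position i
      at-last  : Position (suc N)

    position : ∀ i → i < n → Position i
    position zero    _                = at-first
    position (suc i) (s≤s (s≤s i≤N)) with i ℕ.≟ N
    ... | yes refl = at-last
    ... | no  i≢N  = interior (s≤s z≤n) (≤∧≢⇒< i≤N i≢N)

    -- λⁿ + ωⁿ as a natural number indexed by position: (n+1, n−1, n−2, …, 2, 0).
    base : ℕ → ℕ
    base i = (if does (i ℕ.≟ 0) then 2 else if does (suc i ℕ.≟ n) then 0 else 1) + (n ∸ suc i)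

    base-correct : ∀ k → λⁿ n k ℤ.+ ω n k ≡ + base (toℕ k)
    base-correct k with does (toℕ k ℕ.≟ 0)
    ... | true  = refl
    ... | false with does (suc (toℕ k) ℕ.≟ n)
    ...   | true  = refl
    ...   | false = refl

    base-last : base (suc N) ≡ 0
    base-last rewrite dec-true (n ℕ.≟ n) refl | n∸n≡0 n = refl

    base-interior : ∀ {i} → 1 ≤ i → i ≤ N → base i + i ≡ n
    base-interior {suc i} _ i<N = begin
      base (suc i) + suc i     ≡⟨ cong (λ b → (if b then 0 else 1) + (N ∸ i) + suc i) not-last ⟩
      suc (N ∸ i + suc i)      ≡⟨ cong suc (+-suc (N ∸ i) i) ⟩
      suc (suc (N ∸ i + i))    ≡⟨ cong (suc ∘ suc) (m∸n+n≡m (<⇒≤ i<N)) ⟩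
      n                        ∎
      where
      open ≡-Reasoning
      not-last : does (suc (suc i) ℕ.≟ n) ≡ false
      not-last = dec-false (suc (suc i) ℕ.≟ n) (<⇒≢ i<N ∘ suc-injective ∘ suc-injective)

    base-after-first : ∀ {i} → i < n → 1 ≤ i → base i + i ≤ n
    base-after-first {i} i<n 1≤i with position i i<n
    ... | interior 1≤i i≤N = ≤-reflexive (base-interior 1≤i i≤N)
    ... | at-last          = ≤-trans (≤-reflexive (cong (_+ suc N) base-last)) (n≤1+n (suc N))

    base-before-last : ∀ {i} → i ≤ N → n ≤ base i + i
    base-before-last {i} i≤N with position i (s≤s (m≤n⇒m≤1+n i≤N))
    ... | at-first           = ≤-trans (n≤1+n n) (m≤m+n (suc n) 0)
    ... | interior 1≤i _     = ≤-reflexive (sym (base-interior 1≤i i≤N))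
    ... | at-last            = ⊥-elim (1+n≰n i≤N)

    base-decreasing : ∀ {i j} → i < j → j < n → base j < base i
    base-decreasing {i} {j} i<j j<n = +-cancelʳ-< j (base j) (base i) (begin-strict
      base j + j ≤⟨ base-after-first j<n (≤-trans (s≤s z≤n) i<j) ⟩
      n          ≤⟨ base-before-last (s≤s⁻¹ (≤-trans i<j (s≤s⁻¹ j<n))) ⟩
      base i + i <⟨ +-monoʳ-< (base i) i<j ⟩
      base i + j ∎)
      where open ≤-Reasoning

    base-interior-range : ∀ {m} → 1 ≤ m → m ≤ N → 2 ≤ base m × base m < n
    base-interior-range {m} 1≤m m≤N =
      +-cancelʳ-≤ N 2 (base m) (≤-trans (≤-reflexive (sym (base-interior 1≤m m≤N))) (+-monoʳ-≤ (base m) m≤N)) ,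
      ≤-trans (≤-reflexive (+-comm 1 (base m))) (≤-trans (+-monoʳ-≤ (base m) 1≤m) (≤-reflexive (base-interior 1≤m m≤N)))

    outdeg indeg : Fin n → ℕ
    outdeg k = count (E k)
    indeg  k = count (λ a → E a k)

    -- t = λⁿ + ωⁿ + v(E) with v(E) = in − out, moved into ℕ.
    balance : ∀ k → t k + outdeg k ≡ base (toℕ k) + indeg k
    balance k = ℤP.+-injective (begin
      + (t k + outdeg k)                           ≡⟨ ℤP.pos-+ (t k) (outdeg k) ⟩
      + t k ℤ.+ + outdeg k                         ≡⟨ cong (λ x → x ℤ.+ + outdeg k) (sym (t-def k)) ⟩
      λⁿ n k ℤ.+ ω n k ℤ.+ vE E k ℤ.+ + outdeg k   ≡⟨ cong₂ (λ x y → x ℤ.+ y ℤ.+ + outdeg k) (base-correct k) (vE-degrees E k) ⟩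
      + base (toℕ k) ℤ.+ (+ indeg k ℤ.- + outdeg k) ℤ.+ + outdeg k ≡⟨ cancel (+ base (toℕ k)) (+ indeg k) (+ outdeg k) ⟩
      + base (toℕ k) ℤ.+ + indeg k                 ≡⟨ sym (ℤP.pos-+ (base (toℕ k)) (indeg k)) ⟩
      + (base (toℕ k) + indeg k)                   ∎)
      where
      open ≡-Reasoning
      cancel : ∀ a b c → a ℤ.+ (b ℤ.- c) ℤ.+ c ≡ a ℤ.+ b
      cancel = solve-∀

    value-at-rest : ∀ p → outdeg p ≡ 0 → indeg p ≡ 0 → t p ≡ base (toℕ p)
    value-at-rest p out≡0 in≡0 = begin
      t p                       ≡⟨ sym (+-identityʳ (t p)) ⟩
      t p + 0                   ≡⟨ cong (_+_ (t p)) (sym out≡0) ⟩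
      t p + outdeg p            ≡⟨ balance p ⟩
      base (toℕ p) + indeg p    ≡⟨ cong (_+_ (base (toℕ p))) in≡0 ⟩
      base (toℕ p) + 0          ≡⟨ +-identityʳ _ ⟩
      base (toℕ p)              ∎
      where open ≡-Reasoning

    -- Edges of E skip at least one vertex, because the path edges lie in G.
    long-edge : ∀ a c → E a c ≡ true → 2 + toℕ a ≤ toℕ c
    long-edge a c e with E⊆F a c e
    ... | a<c , ¬G = ≤∧≢⇒< a<c (¬G ∘ path a c)

    -- If no vertex before m has out-edges, the in-edges of p start in [m, p − 1).
    indeg-window : ∀ m → (∀ a → toℕ a < m → outdeg a ≡ 0) → ∀ p → indeg p ≤ pred (toℕ p) ∸ m
    indeg-window m out-free p = count-window (λ a → E a p) m (pred (toℕ p)) (λ a e →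
      ≮⇒≥ (λ a<m → count-zero (E a) (out-free a a<m) p e) , pred-mono-≤ (long-edge a p e))

    -- If no vertex after m has in-edges, the out-edges of p end in [p + 2, m + 1).
    outdeg-window : ∀ m → (∀ c → m < toℕ c → indeg c ≡ 0) → ∀ p → outdeg p ≤ suc m ∸ (2 + toℕ p)
    outdeg-window m in-free p = count-window (E p) (2 + toℕ p) (suc m) (λ c e →
      long-edge p c e , s≤s (≮⇒≥ (λ m<c → count-zero (λ a → E a c) (in-free c m<c) p e)))

    indeg-bound : ∀ k → indeg k ≤ pred (toℕ k)
    indeg-bound = indeg-window 0 (λ _ ())

    outdeg-bound : ∀ k → outdeg k ≤ n ∸ (2 + toℕ k)
    outdeg-bound = outdeg-window (suc N) (λ c N+1<c → ⊥-elim (<⇒≱ (FinP.toℕ<n c) N+1<c))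

    below-n : ∀ k → toℕ k ≢ 0 → t k < n
    below-n k k≢0 = begin-strict
      t k                          ≤⟨ m≤m+n (t k) (outdeg k) ⟩
      t k + outdeg k               ≡⟨ balance k ⟩
      base (toℕ k) + indeg k       ≤⟨ +-monoʳ-≤ (base (toℕ k)) (indeg-bound k) ⟩
      base (toℕ k) + pred (toℕ k)  <⟨ +-monoʳ-< (base (toℕ k)) pred<k ⟩
      base (toℕ k) + toℕ k         ≤⟨ base-after-first (FinP.toℕ<n k) 1≤k ⟩
      n                            ∎
      where
      open ≤-Reasoning
      1≤k : 1 ≤ toℕ k
      1≤k = ≤∧≢⇒< z≤n (k≢0 ∘ sym)
      pred<k : pred (toℕ k) < toℕ k
      pred<k with toℕ k | 1≤k
      ... | suc j | _ = ≤-refl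

    above-1 : ∀ k → toℕ k ≢ suc N → 2 ≤ t k
    above-1 k k≢N+1 = +-cancelʳ-≤ (toℕ k + outdeg k) 2 (t k) (begin
      2 + (toℕ k + outdeg k)       ≡⟨ sym (+-assoc 2 (toℕ k) (outdeg k)) ⟩
      2 + toℕ k + outdeg k         ≤⟨ window-sum (outdeg-bound k) (s≤s (s≤s k≤N)) ⟩
      n                            ≤⟨ base-before-last k≤N ⟩
      base (toℕ k) + toℕ k         ≤⟨ +-monoˡ-≤ (toℕ k) (m≤m+n _ (indeg k)) ⟩
      base (toℕ k) + indeg k + toℕ k ≡⟨ cong (_+ toℕ k) (sym (balance k)) ⟩
      t k + outdeg k + toℕ k       ≡⟨ +-assoc (t k) (outdeg k) (toℕ k) ⟩
      t k + (outdeg k + toℕ k)     ≡⟨ cong (_+_ (t k)) (+-comm (outdeg k) (toℕ k)) ⟩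
      t k + (toℕ k + outdeg k)     ∎)
      where
      open ≤-Reasoning
      k≤N : toℕ k ≤ N
      k≤N = s≤s⁻¹ (≤∧≢⇒< (s≤s⁻¹ (FinP.toℕ<n k)) k≢N+1)

    interior-vertex : Fin N → Fin n
    interior-vertex i = Fsuc (inject₁ i)

    toℕ-interior : ∀ i → toℕ (interior-vertex i) ≡ suc (toℕ i)
    toℕ-interior i = cong suc (FinP.toℕ-inject₁ i)

    -- Their values are N distinct naturals in [2, 2 + N), hence exactly that interval.
    interior-values : ∃ λ (π : Permutation′ N) → ∀ i → t (interior-vertex i) ≡ 2 + toℕ (π ⟨$⟩ʳ i)
    interior-values = interval-permutation (t ∘ interior-vertex) 2
      (λ eq → FinP.inject₁-injective (FinP.suc-injective (t-inj eq))) in-range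
      where
      in-range : ∀ i → 2 ≤ t (interior-vertex i) × t (interior-vertex i) < 2 + N
      in-range i = above-1 (interior-vertex i) (λ eq → <⇒≢ (FinP.toℕ<n i) (suc-injective (trans (sym (toℕ-interior i)) eq))) ,
                   below-n (interior-vertex i) (λ ())

    attains : ∀ v → 2 ≤ v → v < n → ∃ λ i → t (interior-vertex i) ≡ v
    attains v 2≤v v<n = π ⟨$⟩ˡ y , (begin
      t (interior-vertex (π ⟨$⟩ˡ y))    ≡⟨ t≡ (π ⟨$⟩ˡ y) ⟩
      2 + toℕ (π ⟨$⟩ʳ (π ⟨$⟩ˡ y))       ≡⟨ cong (λ j → 2 + toℕ j) (inverseʳ π) ⟩
      2 + toℕ y                          ≡⟨ cong (_+_ 2) (FinP.toℕ-fromℕ< offset<N) ⟩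
      2 + (v ∸ 2)                        ≡⟨ m+[n∸m]≡n 2≤v ⟩
      v                                  ∎)
      where
      open ≡-Reasoning
      π : Permutation′ N
      π = proj₁ interior-values
      t≡ : ∀ i → t (interior-vertex i) ≡ 2 + toℕ (π ⟨$⟩ʳ i)
      t≡ = proj₂ interior-values
      offset<N : v ∸ 2 < N
      offset<N = +-cancelˡ-< 2 (v ∸ 2) N (subst (_< n) (sym (m+[n∸m]≡n 2≤v)) v<n)
      y : Fin N
      y = fromℕ< offset<N

    -- The value of vertex 0 is at least 2 and differs from all interior values.
    first-large : n ≤ t Fzero
    first-large = ≮⇒≥ λ t<n → Fsuc≢Fzero (t-inj (proj₂ (attains (t Fzero) (above-1 Fzero 0≢N+1) t<n)))
      where
      0≢N+1 : 0 ≢ suc N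
      0≢N+1 ()
      Fsuc≢Fzero : ∀ {j : Fin (suc N)} → Fsuc j ≢ Fzero
      Fsuc≢Fzero ()

    -- The value of the last vertex is below n and differs from all interior values.
    last-small : t lst ≤ 1
    last-small = s≤s⁻¹ (≰⇒> λ 2≤t → interior≢last (t-inj (proj₂ (attains (t lst) 2≤t t<n))))
      where
      t<n : t lst < n
      t<n = below-n lst (λ eq → 1+n≢0 (trans (sym toℕ-lst) eq))
      interior≢last : ∀ {i} → interior-vertex i ≢ lst
      interior≢last {i} eq = <⇒≢ (FinP.toℕ<n i)
        (suc-injective (trans (sym (toℕ-interior i)) (trans (cong toℕ eq) toℕ-lst)))

    outdeg-last : ∀ a → toℕ a ≡ suc N → outdeg a ≡ 0
    outdeg-last a a≡N+1 = n≤0⇒n≡0 (≤-trans (outdeg-bound a)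
      (≤-reflexive (m≤n⇒m∸n≡0 (subst (λ x → n ≤ 2 + x) (sym a≡N+1) (n≤1+n n)))))

    OutFree-before : ℕ → Set
    OutFree-before m = ∀ a → toℕ a < m → outdeg a ≡ 0

    indeg-early : ∀ {m} → OutFree-before m → ∀ p → toℕ p ≤ m → indeg p ≡ 0
    indeg-early {m} out-free p p≤m =
      n≤0⇒n≡0 (≤-trans (indeg-window m out-free p) (≤-reflexive (m≤n⇒m∸n≡0 (≤-trans pred[n]≤n p≤m))))

    -- After an interior m, values are below base m: in-edges can only come from [m, p − 1).
    late-small : ∀ {m} → 1 ≤ m → m ≤ N → OutFree-before m → ∀ p → m < toℕ p → t p < base m
    late-small {m} 1≤m m≤N out-free p m<p = +-cancelʳ-< m (t p) (base m) (begin-strict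
      t p + m                                ≤⟨ +-monoˡ-≤ m (m≤m+n (t p) (outdeg p)) ⟩
      t p + outdeg p + m                     ≡⟨ cong (_+ m) (balance p) ⟩
      base (toℕ p) + indeg p + m             ≤⟨ +-monoˡ-≤ m (+-monoʳ-≤ (base (toℕ p)) (indeg-window m out-free p)) ⟩
      base (toℕ p) + (pred (toℕ p) ∸ m) + m  ≡⟨ +-assoc (base (toℕ p)) _ m ⟩
      base (toℕ p) + (pred (toℕ p) ∸ m + m)  ≡⟨ cong (_+_ (base (toℕ p))) (m∸n+n≡m (<⇒≤pred m<p)) ⟩
      base (toℕ p) + pred (toℕ p)            <⟨ +-monoʳ-< (base (toℕ p)) (pred< m<p) ⟩
      base (toℕ p) + toℕ p                   ≤⟨ base-after-first (FinP.toℕ<n p) (≤-trans 1≤m (<⇒≤ m<p)) ⟩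
      n                                      ≡⟨ sym (base-interior 1≤m m≤N) ⟩
      base m + m                             ∎)
      where
      open ≤-Reasoning
      pred< : ∀ {x} → m < x → pred x < x
      pred< (s≤s _) = ≤-refl

    forward-located : ∀ {m} → 1 ≤ m → m ≤ N → OutFree-before m → ∀ p → t p ≡ base m → toℕ p ≡ m
    forward-located {m} 1≤m m≤N out-free p tp≡ with <-cmp (toℕ p) m
    ... | tri≈ _ p≡m _ = p≡m
    ... | tri> _ _ m<p = ⊥-elim (<⇒≢ (late-small 1≤m m≤N out-free p m<p) tp≡)
    ... | tri< p<m _ _ = ⊥-elim (<⇒≢ (base-decreasing p<m (s≤s (m≤n⇒m≤1+n m≤N))) (sym (trans rest tp≡)))
      where
      rest : base (toℕ p) ≡ t p
      rest = sym (value-at-rest p (out-free p p<m) (indeg-early out-free p (<⇒≤ p<m)))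

    out-free-interior : ∀ {m} → 1 ≤ m → m ≤ N → OutFree-before m → ∀ a → toℕ a ≡ m → outdeg a ≡ 0
    out-free-interior {m} 1≤m m≤N out-free a a≡m = +-cancelˡ-≡ (t a) (outdeg a) 0 (begin
      t a + outdeg a          ≡⟨ balance a ⟩
      base (toℕ a) + indeg a  ≡⟨ cong₂ _+_ (cong base a≡m) (indeg-early out-free a (≤-reflexive a≡m)) ⟩
      base m + 0              ≡⟨ cong (_+ 0) (sym ta≡) ⟩
      t a + 0                 ∎)
      where
      open ≡-Reasoning
      carrier : ∃ λ i → t (interior-vertex i) ≡ base m
      carrier = attains (base m) (proj₁ (base-interior-range 1≤m m≤N)) (proj₂ (base-interior-range 1≤m m≤N))
      carrier≡a : interior-vertex (proj₁ carrier) ≡ a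
      carrier≡a = FinP.toℕ-injective (trans (forward-located 1≤m m≤N out-free _ (proj₂ carrier)) (sym a≡m))
      ta≡ : t a ≡ base m
      ta≡ = trans (cong t (sym carrier≡a)) (proj₂ carrier)

    all-out-free : outdeg Fzero ≡ 0 → ∀ m → OutFree-before m
    all-out-free out₀≡0 zero    a ()
    all-out-free out₀≡0 (suc m) a a<1+m with m<1+n⇒m<n∨m≡n a<1+m
    ... | inj₁ a<m = all-out-free out₀≡0 m a a<m
    ... | inj₂ a≡m with position m (subst (_< n) a≡m (FinP.toℕ<n a))
    ...   | at-first         = subst (λ x → outdeg x ≡ 0) (sym (FinP.toℕ-injective {j = Fzero} a≡m)) out₀≡0
    ...   | interior 1≤m m≤N = out-free-interior 1≤m m≤N (all-out-free out₀≡0 m) a a≡m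
    ...   | at-last          = outdeg-last a a≡m

    InFree-after : ℕ → Set
    InFree-after m = ∀ c → m < toℕ c → indeg c ≡ 0

    outdeg-late : ∀ {m} → InFree-after m → ∀ p → m ≤ toℕ p → outdeg p ≡ 0
    outdeg-late {m} in-free p m≤p =
      n≤0⇒n≡0 (≤-trans (outdeg-window m in-free p) (≤-reflexive (m≤n⇒m∸n≡0 (s≤s (≤-trans m≤p (n≤1+n _))))))

    -- Before an interior m, values exceed base m: out-edges can only end in [p + 2, m + 1).
    early-large : ∀ {m} → 1 ≤ m → m ≤ N → InFree-after m → ∀ p → toℕ p < m → base m < t p
    early-large {m} 1≤m m≤N in-free p p<m = +-cancelʳ-< m (base m) (t p) (begin-strict
      base m + m                       ≡⟨ base-interior 1≤m m≤N ⟩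
      n                                ≤⟨ base-before-last (≤-trans (<⇒≤ p<m) m≤N) ⟩
      base (toℕ p) + toℕ p             ≤⟨ +-monoˡ-≤ (toℕ p) (m≤m+n _ (indeg p)) ⟩
      base (toℕ p) + indeg p + toℕ p   ≡⟨ cong (_+ toℕ p) (sym (balance p)) ⟩
      t p + outdeg p + toℕ p           ≡⟨ +-assoc (t p) (outdeg p) (toℕ p) ⟩
      t p + (outdeg p + toℕ p)         ≡⟨ cong (_+_ (t p)) (+-comm (outdeg p) (toℕ p)) ⟩
      t p + (toℕ p + outdeg p)         <⟨ +-monoʳ-< (t p) p+out<m ⟩
      t p + m                          ∎)
      where
      open ≤-Reasoning
      p+out<m : toℕ p + outdeg p < m
      p+out<m = s≤s⁻¹ (window-sum (outdeg-window m in-free p) (s≤s p<m))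

    backward-located : ∀ {m} → 1 ≤ m → m ≤ N → InFree-after m → ∀ p → t p ≡ base m → toℕ p ≡ m
    backward-located {m} 1≤m m≤N in-free p tp≡ with <-cmp (toℕ p) m
    ... | tri≈ _ p≡m _ = p≡m
    ... | tri< p<m _ _ = ⊥-elim (<⇒≢ (early-large 1≤m m≤N in-free p p<m) (sym tp≡))
    ... | tri> _ _ m<p = ⊥-elim (<⇒≢ (base-decreasing m<p (FinP.toℕ<n p)) (trans (sym rest) tp≡))
      where
      rest : t p ≡ base (toℕ p)
      rest = value-at-rest p (outdeg-late in-free p (<⇒≤ m<p)) (in-free p m<p)

    in-free-interior : ∀ {m} → 1 ≤ m → m ≤ N → InFree-after m → ∀ c → toℕ c ≡ m → indeg c ≡ 0
    in-free-interior {m} 1≤m m≤N in-free c c≡m = sym (+-cancelˡ-≡ (base m) 0 (indeg c) (begin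
      base m + 0              ≡⟨ cong (_+ 0) (sym tc≡) ⟩
      t c + 0                 ≡⟨ cong (_+_ (t c)) (sym (outdeg-late in-free c (≤-reflexive (sym c≡m)))) ⟩
      t c + outdeg c          ≡⟨ balance c ⟩
      base (toℕ c) + indeg c  ≡⟨ cong (λ i → base i + indeg c) c≡m ⟩
      base m + indeg c        ∎))
      where
      open ≡-Reasoning
      carrier : ∃ λ i → t (interior-vertex i) ≡ base m
      carrier = attains (base m) (proj₁ (base-interior-range 1≤m m≤N)) (proj₂ (base-interior-range 1≤m m≤N))
      carrier≡c : interior-vertex (proj₁ carrier) ≡ c
      carrier≡c = FinP.toℕ-injective (trans (backward-located 1≤m m≤N in-free _ (proj₂ carrier)) (sym c≡m))
      tc≡ : t c ≡ base m
      tc≡ = trans (cong t (sym carrier≡c)) (proj₂ carrier)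

    -- Induction on d, from m = N+1 (d = 0) down to m = 0 (d = N+1).
    all-in-free : indeg lst ≡ 0 → ∀ d {m} → d + m ≡ suc N → InFree-after m
    all-in-free in-last≡0 zero    refl c N+1<c = ⊥-elim (<⇒≱ (FinP.toℕ<n c) N+1<c)
    all-in-free in-last≡0 (suc d) {m} d+m≡ c m<c with m≤n⇒m<n∨m≡n m<c
    ... | inj₁ m+1<c = all-in-free in-last≡0 d (trans (+-suc d m) d+m≡) c m+1<c
    ... | inj₂ m+1≡c with position (suc m) (subst (_< n) (sym m+1≡c) (FinP.toℕ<n c))
    ...   | interior 1≤m m≤N = in-free-interior 1≤m m≤N (all-in-free in-last≡0 d (trans (+-suc d m) d+m≡)) c (sym m+1≡c)
    ...   | at-last          = subst (λ x → indeg x ≡ 0) (FinP.toℕ-injective (trans toℕ-lst m+1≡c)) in-last≡0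

    -- t 0 + out(0) = n + 1, since vertex 0 receives nothing.
    first-balance : t Fzero + outdeg Fzero ≡ suc n
    first-balance = trans (balance Fzero) (trans (cong (_+_ (suc n)) (n≤0⇒n≡0 (indeg-bound Fzero))) (+-identityʳ _))

    -- With t 0 ≥ n this leaves out(0) ∈ {0, 1}.
    outdeg-first-0-or-1 : outdeg Fzero ≡ 0 ⊎ outdeg Fzero ≡ 1
    outdeg-first-0-or-1 = ≤1⇒0⊎1 (+-cancelˡ-≤ n (outdeg Fzero) 1
      (≤-trans (+-monoˡ-≤ (outdeg Fzero) first-large) (≤-reflexive (trans first-balance (+-comm 1 n)))))

    -- t (N+1) = in(N+1), since the last vertex sends nothing and base (N+1) = 0.
    last-balance : t lst ≡ indeg lst
    last-balance = begin
      t lst                   ≡⟨ sym (+-identityʳ (t lst)) ⟩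
      t lst + 0               ≡⟨ cong (_+_ (t lst)) (sym (outdeg-last lst toℕ-lst)) ⟩
      t lst + outdeg lst      ≡⟨ balance lst ⟩
      base (toℕ lst) + indeg lst ≡⟨ cong (λ i → base i + indeg lst) toℕ-lst ⟩
      base (suc N) + indeg lst   ≡⟨ cong (_+ indeg lst) base-last ⟩
      indeg lst               ∎
      where open ≡-Reasoning

    no-edges : outdeg Fzero ≡ 0 → ∀ k → + t k ≡ λⁿ n k ℤ.+ ω n k
    no-edges out₀≡0 k = trans (cong +_ (value-at-rest k (all-out-free out₀≡0 n k k<n) (indeg-early (all-out-free out₀≡0 n) k (<⇒≤ k<n))))
                              (sym (base-correct k))
      where
      k<n : toℕ k < n
      k<n = FinP.toℕ<n k

    vertex-cases : ∀ k → k ≡ Fzero ⊎ k ≡ lst ⊎ (toℕ k ≢ 0 × toℕ k ≢ suc N)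
    vertex-cases k with toℕ k ℕ.≟ 0 | toℕ k ℕ.≟ suc N
    ... | yes k≡0 | _         = inj₁ (FinP.toℕ-injective k≡0)
    ... | no  _   | yes k≡N+1 = inj₂ (inj₁ (FinP.toℕ-injective (trans k≡N+1 (sym toℕ-lst))))
    ... | no  k≢0 | no  k≢N+1 = inj₂ (inj₂ (k≢0 , k≢N+1))

    module OneEdgeFromFirst (out₀≡1 : outdeg Fzero ≡ 1) where

      t-first : t Fzero ≡ n
      t-first = +-cancelʳ-≡ 1 (t Fzero) n (trans (cong (_+_ (t Fzero)) (sym out₀≡1)) (trans first-balance (+-comm 1 n)))

      -- in(N+1) = 0 would make all in-degrees vanish, hence also out(0).
      last-value : indeg lst ≡ 0 ⊎ indeg lst ≡ 1 → t lst ≡ 1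
      last-value (inj₂ in≡1) = trans last-balance in≡1
      last-value (inj₁ in≡0) = ⊥-elim (1+n≢0 (trans (sym out₀≡1)
                                 (outdeg-late (all-in-free in≡0 (suc N) (+-identityʳ (suc N))) Fzero z≤n)))

      t-last : t lst ≡ 1
      t-last = last-value (≤1⇒0⊎1 (subst (_≤ 1) last-balance last-small))

      -- All values lie in [1, n]: n at vertex 0, 1 at the last vertex, [2, n) elsewhere.
      InRange : Fin n → Set
      InRange k = 1 ≤ t k × t k < 1 + n

      in-range : ∀ k → InRange k
      in-range k = range (vertex-cases k)
        where
        range : k ≡ Fzero ⊎ k ≡ lst ⊎ (toℕ k ≢ 0 × toℕ k ≢ suc N) → InRange k
        range (inj₁ k≡0) = subst InRange (sym k≡0)
          (≤-trans (s≤s z≤n) (≤-reflexive (sym t-first)) , s≤s (≤-reflexive t-first))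
        range (inj₂ (inj₁ k≡L)) = subst InRange (sym k≡L)
          (≤-reflexive (sym t-last) , s≤s (≤-trans (≤-reflexive t-last) (s≤s z≤n)))
        range (inj₂ (inj₂ (k≢0 , k≢L))) = ≤-trans (n≤1+n 1) (above-1 k k≢L) , m<n⇒m<1+n (below-n k k≢0)

      t-permutation : ∃ λ (π : Permutation′ n) → ∀ k → t k ≡ suc (toℕ (π ⟨$⟩ʳ k))
      t-permutation = interval-permutation t 1 t-inj in-range

    one-edge-from-first : outdeg Fzero ≡ 1 →
                          (∃ λ (π : Permutation′ n) → ∀ k → t k ≡ suc (toℕ (π ⟨$⟩ʳ k)))
                          × t Fzero ≡ n × t lst ≡ 1
    one-edge-from-first out₀≡1 = t-permutation , t-first , t-last
      where open OneEdgeFromFirst out₀≡1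

open import Defs
open import Data.Nat using (ℕ; suc; _≤_)
open import Data.Integer using (+_; _+_)
open import Data.Fin using (Fin; toℕ; _<_)
open import Data.Fin.Permutation using (Permutation′; _⟨$⟩ʳ_)
open import Data.Product using (∃; _×_)
open import Data.Sum using (_⊎_)
open import Relation.Binary.PropositionalEquality using (_≡_)
open import Data.Nat using (s≤s)
open import Data.Product using (_,_)
import Data.Sum as Sum
open NonPathEdges using (module Setting)

mainTheorem4 :
    (n : ℕ) → (2≤n : 2 ≤ n) →
    (G : Fin n → Fin n → Set) →
    (∀ i j → G i j → i < j) →
    (∀ (i : Fin n) (j : Fin n) → suc (toℕ i) ≡ toℕ j → G i j) →
    (t : Fin n → ℕ) →
    𝒩 n (λⁿ n) (Eₙ −G G) t →
    (∀ k → + t k ≡ λⁿ n k + ω n k)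
    ⊎ ((∃ λ (π : Permutation′ n) → ∀ k → t k ≡ suc (toℕ (π ⟨$⟩ʳ k)))
       × t (first n 2≤n) ≡ n
       × t (last n 2≤n) ≡ 1)
mainTheorem4 (suc (suc N)) (s≤s (s≤s _)) G _ path t (distinct , E , E⊆F , t-def) =
  Sum.map no-edges one-edge-from-first outdeg-first-0-or-1
  where open Setting N G path t distinct E E⊆F t-def
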